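{- Let $(\mathcal{U},\mathcal{F})$ be a Set Cover instance, let $G = f(\mathcal{U},\mathcal{F})$, and let $x \in \mathcal{U}$. If there is an ordering $L$ of $G_x$ with $\mathrm{wcol}_c(G_x, L) \le t$, then there exists an ordering $L'$ of $G_x$ with $\mathrm{wcol}_c(G_x, L') \le \mathrm{wcol}_c(G_x, L)$ such that, for every $S \in \mathcal{F}$ with $x \in S$: (1) $L'(d_1) < L'(v_S^1)$ for all $d_1 \in D_S^1 \setminus\{v_S^1\}$; (2) $L'(d_2) < L'(v_S^2)$ for all $d_2 \in D_S^2\setminus\{v_S^2\}$; and (3) $L'(d) < L'(p_{S,x}^1)$ for all $d \in D_{S,x}$.
   Context: Graphs are finite and simple. An ordering of a graph $H$ is a bijection $L: V(H) \to \{1,\dots,|V(H)|\}$. For an integer $c$, an ordering $L$ and a vertex $v$, $\mathrm{WReach}_c[H,L,v]$ is the set of vertices $u \neq v$ such that there is a path in $H$ from $v$ to $u$ with at most $c$ edges all of whose vertices $w$ satisfy $L(w) \le L(u)$; $\mathrm{wcol}_c(H,L) = \max_v |\mathrm{WReach}_c[H,L,v]|$, $\mathrm{wcol}_c(H) = \min_L \mathrm{wcol}_c(H,L)$. Construction: a Set Cover instance $(\mathcal{U},\mathcal{F})$ consists of a finite universe $\mathcal{U}$ and a family $\mathcal{F}$ of subsets of $\mathcal{U}$, each element lying in at least one set; $f_x$ is the number of sets containing $x$ and $f_{\max} = \max_x f_x$. Fix an integer $c \ge 3$, let $\ell = \lfloor c/2 \rfloor$, and let $t$ be the smallest integer with $t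 \ge 4 f_{\max}$ and $t \ge \ell + 3 f_{\max} - 2$. For $S \in \mathcal{F}$, the set gadget $W_S$ consists of disjoint cliques $D_S^1$ on $t$ vertices and $D_S^2$ on $t+1$ vertices, with distinguished vertices $v_S^1 \in D_S^1$, $v_S^2 \in D_S^2$ joined by an edge. For $x \in \mathcal{U}$, the element gadget $G_x$ consists of a clique $D_x$ on $t - 3f_x + 2$ vertices and, for each $S \in \mathcal{F}$ with $x \in S$: the set gadget $W_S$, a clique $D_{S,x}$ on $f_x$ vertices, and a path $p_{S,x}^1, \dots, p_{S,x}^\ell$ of $\ell$ new vertices, where $p_{S,x}^1$ is adjacent to every vertex of $D_x$ and of $D_{S,x}$, and $p_{S,x}^\ell$ is adjacent to $v_S^1$. The graph $G = f(\mathcal{U},\mathcal{F})$ is the union of all $G_x$, $x \in \mathcal{U}$, where for each $S$ there is a single copy of $W_S$ shared by all $G_x$ with $x \in S$ (all other parts are disjoint); each $G_x$ is an induced subgraph of $G$. -}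

module Defs where

open import Data.Nat using (ℕ; zero; suc; _+_; _*_; _∸_; _⊔_; _≤_; _<_; ⌊_/2⌋)
open import Data.Fin as Fin using (Fin; toℕ)
open import Data.Fin.Subset using (Subset; _∈_)
open import Data.Fin.Subset.Properties using (_∈?_)
open import Data.List using (List; []; _∷_; length; filter; map; foldr; allFin)
open import Data.List.Relation.Unary.All using (All)
open import Data.List.Relation.Unary.Unique.Propositional using (Unique)
open import Data.Product using (Σ; ∃; _×_; _,_; proj₁; proj₂)
open import Data.Sum using (_⊎_)
open import Function.Bundles using (_↔_; Inverse)
open import Relation.Binary.PropositionalEquality using (_≡_; _≢_)

-- An ordering of a graph with vertex type V: a bijection from V onto
-- {0,…,k-1} (0-based version of {1,…,|V|}; k is necessarily |V|).
Ordering : Set → Set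
Ordering V = Σ ℕ (λ k → V ↔ Fin k)

pos : {V : Set} → Ordering V → V → ℕ
pos (k , L) v = toℕ (Inverse.to L v)

data Walk {V : Set} (Adj : V → V → Set) : V → V → List V → Set where
  here : ∀ {v} → Walk Adj v v (v ∷ [])
  step : ∀ {v w u ws} → Adj v w → Walk Adj w u ws → Walk Adj v u (v ∷ ws)

Path : {V : Set} (Adj : V → V → Set) → V → V → List V → Set
Path Adj v u ws = Walk Adj v u ws × Unique ws

-- u ∈ WReach_c[H,L,v]: u ≠ v and there is a path from v to u with at
-- most c edges (i.e. at most c+1 vertices) all of whose vertices w
-- satisfy L(w) ≤ L(u).
WReach : {V : Set} (Adj : V → V → Set) (c : ℕ) (L : Ordering V) (v u : V) → Set
WReach Adj c L v u =
  (u ≢ v) × Σ (List _) (λ ws → Path Adj v u ws × length ws ≤ suc c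
                               × All (λ w → pos L w ≤ pos L u) ws)

-- |{u | A u}| ≤ m : there is a map into Fin m injective on the vertices.
AtMost : {V : Set} → (V → Set) → ℕ → Set
AtMost {V} A m =
  Σ ((u : V) → A u → Fin m) λ f →
    ∀ u u' (a : A u) (a' : A u') → f u a ≡ f u' a' → u ≡ u'

WcolLe : {V : Set} (Adj : V → V → Set) (c : ℕ) (L : Ordering V) (m : ℕ) → Set
WcolLe Adj c L m = ∀ v → AtMost (WReach Adj c L v) m

record SetCover : Set where
  field
    n      : ℕ
    m      : ℕ
    F      : Fin m → Subset n
    covers : ∀ (x : Fin n) → ∃ λ S → x ∈ F S

open SetCover public

freq : (I : SetCover) → Fin (n I) → ℕ
freq I x = length (filter (λ S → x ∈? F I S) (allFin (m I)))

fmax : SetCover → ℕ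
fmax I = foldr _⊔_ 0 (map (freq I) (allFin (n I)))

ell : ℕ → ℕ
ell c = ⌊ c /2⌋

tt : SetCover → ℕ → ℕ
tt I c = (4 * fmax I) ⊔ (ell c + 3 * fmax I ∸ 2)

SetsOf : (I : SetCover) → Fin (n I) → Set
SetsOf I x = Σ (Fin (m I)) λ S → x ∈ F I S

module _ (I : SetCover) (c : ℕ) (x : Fin (n I)) where

  private
    t  = tt I c
    fx = freq I x
    ℓ  = ell c

  data VG : Set where
    dX  : Fin (t ∸ 3 * fx + 2) → VG
    v1  : SetsOf I x → VG
    d1  : SetsOf I x → Fin (t ∸ 1) → VG      -- D_S^1 ∖ {v_S^1}
    v2  : SetsOf I x → VG
    d2  : SetsOf I x → Fin t → VG            -- D_S^2 ∖ {v_S^2}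
    dS  : SetsOf I x → Fin fx → VG
    pth : SetsOf I x → Fin ℓ → VG            -- p_{S,x}^{i+1}

  -- one orientation of each edge
  data EG : VG → VG → Set where
    eDx   : ∀ {i j} → i ≢ j → EG (dX i) (dX j)
    eD1v  : ∀ {S i} → EG (v1 S) (d1 S i)
    eD1   : ∀ {S i j} → i ≢ j → EG (d1 S i) (d1 S j)
    eD2v  : ∀ {S i} → EG (v2 S) (d2 S i)
    eD2   : ∀ {S i j} → i ≢ j → EG (d2 S i) (d2 S j)
    eV12  : ∀ {S} → EG (v1 S) (v2 S)
    eDS   : ∀ {S i j} → i ≢ j → EG (dS S i) (dS S j)
    ePath : ∀ {S i j} → toℕ j ≡ suc (toℕ i) → EG (pth S i) (pth S j)
    eP1Dx : ∀ {S i j} → toℕ i ≡ 0 → EG (pth S i) (dX j)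
    eP1DS : ∀ {S i j} → toℕ i ≡ 0 → EG (pth S i) (dS S j)
    ePℓ   : ∀ {S i} → suc (toℕ i) ≡ ℓ → EG (pth S i) (v1 S)

  AdjG : VG → VG → Set
  AdjG u v = EG u v ⊎ EG v u

module Submission where

-- A vertex e is simplicial if its closed neighbourhood lies in a clique K.
-- Key fact: moving a simplicial vertex to the front of an ordering never
-- increases wcol_c (c ≥ 1).  For v ≠ e, a witnessing path from v cannot end at
-- e (which now comes first), and if it passes through e the two neighbours of e
-- on it are adjacent members of K, so e can be cut out; the other vertices keep
-- their relative order, hence WReach_c[v] only shrinks.  For v = e, let z be
-- the earliest vertex of K in the old ordering: a path e a … u is replaced by
-- z a … u (or by its suffix from z), so z ↦ e, u ↦ u injects the new
-- WReach_c[e] into the old WReach_c[z].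
-- In G_x every vertex of D_S^1 ∖ {v_S^1}, D_S^2 ∖ {v_S^2} and D_{S,x} is
-- simplicial (cliques D_S^1, D_S^2, D_{S,x} ∪ {p_{S,x}^1}); moving all of them
-- to the front, one by one, gives the required ordering.

open import Defs
open import Data.Nat using (ℕ; zero; suc; _≤_; _<_; s≤s; z≤n; s≤s⁻¹)
open import Data.Nat.Properties using (≤-refl; ≤-trans; <⇒≱; ≰⇒>; m≤n⇒m≤1+n)
open import Data.Fin as Fin using (Fin; toℕ; punchIn)
open import Data.Fin.Properties using (punchIn-punchOut; punchIn-mono-≤; toℕ-injective)
  renaming (_≟_ to _≟ᶠ_)
open import Data.Fin.Permutation using (Permutation; insert; id; _⟨$⟩ʳ_; inverseʳ; insert-punchIn)
open import Data.List using (List; []; _∷_; length; map; filter; allFin)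
open import Data.List.Membership.Propositional using (_∈_; _∉_)
open import Data.List.Membership.Propositional.Properties
  using (∈-map⁺; ∈-map⁻; ∈-allFin; ∈-filter⁺; ∈-filter⁻)
import Data.List.Membership.DecPropositional as DecMembership
open import Data.List.Relation.Unary.All as All using (All; []; _∷_)
open import Data.List.Relation.Unary.All.Properties using (¬Any⇒All¬; all-filter)
import Data.List.Relation.Unary.Any as Any
open import Data.List.Relation.Unary.Unique.Propositional using (Unique; []; _∷_)
open import Data.List.Relation.Binary.Sublist.Propositional using (_⊆_; []; _∷_; _∷ʳ_; ⊆-refl)
open import Data.List.Relation.Binary.Sublist.Propositional.Properties using (All-resp-⊆)
open import Data.List.Relation.Binary.Sublist.Heterogeneous.Properties using (length-mono-≤)
open import Data.List.Extrema.Nat using (argmin; argmin-sel; f[argmin]≤f[xs])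
open import Data.Product using (Σ; ∃-syntax; _×_; _,_; proj₁; proj₂)
open import Data.Sum using (_⊎_; inj₁; inj₂; [_,_]′)
open import Data.Empty using (⊥-elim)
open import Function using (_∘_)
open import Function.Bundles using (Inverse; Injection)
open import Function.Properties.Inverse using (↔⇒↣)
open import Function.Construct.Composition using (_↔-∘_)
open import Relation.Nullary using (¬_; yes; no)
open import Relation.Nullary.Decidable using (map′)
open import Relation.Unary using (Decidable)
open import Relation.Binary.Definitions using (DecidableEquality)
open import Relation.Binary.PropositionalEquality
  using (_≡_; _≢_; refl; sym; trans; cong; subst; ≢-sym)

-- The permutation of Fin k moving i to position 0 and shifting the elements
-- before i up by one; it is the library's insert i 0 id.
front : ∀ {k} → Fin k → Permutation k k
front {suc k} i = insert i Fin.zero id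

front-self : ∀ {k} (i : Fin k) → toℕ (front i ⟨$⟩ʳ i) ≡ 0
front-self {suc k} i = cong toℕ (inverseʳ (front i) {Fin.zero})

-- View of the elements j ≠ i as punchIn i j′; front i sends such an element
-- to suc j′ (library lemma insert-punchIn).
data Shifted {k : ℕ} (i : Fin (suc k)) : Fin (suc k) → Set where
  shifted : (j : Fin k) → Shifted i (punchIn i j)

shifted-view : ∀ {k} {i j : Fin (suc k)} → j ≢ i → Shifted i j
shifted-view {i = i} j≢i = subst (Shifted i) (punchIn-punchOut (≢-sym j≢i)) (shifted _)

front-positive : ∀ {k} {i j : Fin k} → j ≢ i → 0 < toℕ (front i ⟨$⟩ʳ j)
front-positive {suc k} {i} j≢i with shifted-view j≢i
... | shifted j rewrite insert-punchIn i Fin.zero id j = s≤s z≤n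

front-reflects-≤ : ∀ {k} {i j l : Fin k} → j ≢ i → l ≢ i →
  toℕ (front i ⟨$⟩ʳ j) ≤ toℕ (front i ⟨$⟩ʳ l) → toℕ j ≤ toℕ l
front-reflects-≤ {suc k} {i} j≢i l≢i le with shifted-view j≢i | shifted-view l≢i
... | shifted j | shifted l
  rewrite insert-punchIn i Fin.zero id j | insert-punchIn i Fin.zero id l =
  punchIn-mono-≤ i j l (s≤s⁻¹ le)

module _ {V : Set} where

  -- An ordering identifies V with Fin k, so equality of vertices is decidable.
  vertex-≟ : Ordering V → DecidableEquality V
  vertex-≟ (k , L) u w =
    map′ (Injection.injective (↔⇒↣ L)) (cong (Inverse.to L)) (Inverse.to L u ≟ᶠ Inverse.to L w)

  rank-≢ : (L : Ordering V) {u w : V} → u ≢ w → Inverse.to (proj₂ L) u ≢ Inverse.to (proj₂ L) w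
  rank-≢ (k , L) u≢w = u≢w ∘ Injection.injective (↔⇒↣ L)

  vertices : Ordering V → List V
  vertices (k , L) = map (Inverse.from L) (allFin k)

  ∈-vertices : (L : Ordering V) (v : V) → v ∈ vertices L
  ∈-vertices (k , L) v =
    subst (_∈ vertices (k , L)) (Inverse.strictlyInverseʳ L v) (∈-map⁺ (Inverse.from L) (∈-allFin (Inverse.to L v)))

  moveToFront : Ordering V → V → Ordering V
  moveToFront (k , L) e = k , (front (Inverse.to L e) ↔-∘ L)

  module _ (L : Ordering V) {e : V} where

    private
      L′ : Ordering V
      L′ = moveToFront L e

    front-first : ∀ {r} → r ≢ e → pos L′ e < pos L′ r
    front-first r≢e rewrite front-self (Inverse.to (proj₂ L) e) = front-positive (rank-≢ L r≢e)

    front-reflects : ∀ {u w} → u ≢ e → w ≢ e → pos L′ u ≤ pos L′ w → pos L u ≤ pos L w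
    front-reflects u≢e w≢e = front-reflects-≤ (rank-≢ L u≢e) (rank-≢ L w≢e)

    front-keeps-before : ∀ {d r} → r ≢ e → pos L d < pos L r → pos L′ d < pos L′ r
    front-keeps-before {d} r≢e d<r with vertex-≟ L d e
    ... | yes refl = front-first r≢e
    ... | no d≢e = ≰⇒> (<⇒≱ d<r ∘ front-reflects r≢e d≢e)

  moveAllToFront : Ordering V → List V → Ordering V
  moveAllToFront L [] = L
  moveAllToFront L (e ∷ es) = moveAllToFront (moveToFront L e) es

  moveAll-keeps-before : (L : Ordering V) (es : List V) {d r : V} → r ∉ es →
    pos L d < pos L r → pos (moveAllToFront L es) d < pos (moveAllToFront L es) r
  moveAll-keeps-before L [] r∉ d<r = d<r
  moveAll-keeps-before L (e ∷ es) r∉ d<r =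
    moveAll-keeps-before (moveToFront L e) es (r∉ ∘ Any.there) (front-keeps-before L (r∉ ∘ Any.here) d<r)

  moveAll-before : (L : Ordering V) (es : List V) {d r : V} → d ∈ es → r ∉ es →
    pos (moveAllToFront L es) d < pos (moveAllToFront L es) r
  moveAll-before L (e ∷ es) (Any.here refl) r∉ =
    moveAll-keeps-before (moveToFront L e) es (r∉ ∘ Any.there) (front-first L (r∉ ∘ Any.here))
  moveAll-before L (e ∷ es) (Any.there d∈) r∉ = moveAll-before (moveToFront L e) es d∈ (r∉ ∘ Any.there)

  AtMost-map : {A B : V → Set} {m : ℕ} (g : V → V) → (∀ {u} → A u → B (g u)) →
    (∀ {u u′} → A u → A u′ → g u ≡ g u′ → u ≡ u′) → AtMost B m → AtMost A m
  AtMost-map g g-maps g-inj (f , f-inj) =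
    (λ u a → f (g u) (g-maps a)) , λ u u′ a a′ eq → g-inj a a′ (f-inj _ _ _ _ eq)

  Unique-resp-⊆ : {xs ys : List V} → xs ⊆ ys → Unique ys → Unique xs
  Unique-resp-⊆ [] [] = []
  Unique-resp-⊆ (y ∷ʳ sub) (_ ∷ uniq) = Unique-resp-⊆ sub uniq
  Unique-resp-⊆ (refl ∷ sub) (y∉ ∷ uniq) = All-resp-⊆ sub y∉ ∷ Unique-resp-⊆ sub uniq

module Graph {V : Set} (Adj : V → V → Set) (Adj-sym : ∀ {a b} → Adj a b → Adj b a) where

  walk-starts : ∀ {a u ws} → Walk Adj a u ws → a ∈ ws
  walk-starts here = Any.here refl
  walk-starts (step _ _) = Any.here refl

  walk-head : ∀ {P : V → Set} {a u ws} → Walk Adj a u ws → All P ws → P a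
  walk-head W ps = All.lookup ps (walk-starts W)

  walk-suffix : ∀ {a u ws z} → Walk Adj a u ws → z ∈ ws → Σ (List V) λ ws′ → Walk Adj z u ws′ × ws′ ⊆ ws
  walk-suffix here (Any.here refl) = _ , here , ⊆-refl
  walk-suffix here (Any.there ())
  walk-suffix (step a~w rest) (Any.here refl) = _ , step a~w rest , ⊆-refl
  walk-suffix (step _ rest) (Any.there z∈) =
    let ws′ , W′ , sub = walk-suffix rest z∈ in ws′ , W′ , _ ∷ʳ sub

  record Simplicial (e : V) : Set where
    field
      clique   : List V
      self∈    : e ∈ clique
      closed   : ∀ {a} → Adj e a → a ∈ clique
      complete : ∀ {a b} → a ∈ clique → b ∈ clique → a ≢ b → Adj a b

  module _ (_≟_ : DecidableEquality V) {e : V} (σ : Simplicial e) where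
    open Simplicial σ

    -- A path through a simplicial vertex e can shortcut it: its two
    -- neighbours on the path are distinct members of the clique.
    bypass : ∀ {v u ws} → Walk Adj v u ws → Unique ws → v ≢ e → u ≢ e →
      Σ (List V) λ ws′ → Walk Adj v u ws′ × ws′ ⊆ ws × All (_≢ e) ws′
    bypass here _ v≢e _ = _ , here , ⊆-refl , v≢e ∷ []
    bypass (step {w = w} v~w rest) (_ ∷ uniq) v≢e u≢e with w ≟ e
    ... | no w≢e =
      let ws′ , W′ , sub , avoids = bypass rest uniq w≢e u≢e
      in _ , step v~w W′ , refl ∷ sub , v≢e ∷ avoids
    bypass (step _ here) _ _ u≢e | yes refl = ⊥-elim (u≢e refl)
    bypass (step v~e (step e~b rest)) ((_ ∷ v∉) ∷ (e∉ ∷ _)) v≢e _ | yes refl =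
      _ , step v~b rest , refl ∷ (_ ∷ʳ ⊆-refl) , v≢e ∷ All.map ≢-sym e∉
      where
        v~b : Adj _ _
        v~b = complete (closed (Adj-sym v~e)) (closed e~b) (walk-head rest v∉)

  module SimplicialFront (c : ℕ) (1≤c : 1 ≤ c) (L : Ordering V) {e : V} (σ : Simplicial e) where
    open Simplicial σ
    open DecMembership (vertex-≟ L) using (_∈?_)

    private
      L′ : Ordering V
      L′ = moveToFront L e
      _≟_ : DecidableEquality V
      _≟_ = vertex-≟ L

    z : V
    z = argmin (pos L) e clique

    z∈clique : z ∈ clique
    z∈clique = [ (λ z≡e → subst (_∈ clique) (sym z≡e) self∈) , (λ z∈ → z∈) ]′ (argmin-sel (pos L) e clique)

    z-least : ∀ {a} → a ∈ clique → pos L z ≤ pos L a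
    z-least = All.lookup (f[argmin]≤f[xs] e clique)

    lower : ∀ {u ws} → u ≢ e → All (_≢ e) ws →
      All (λ w → pos L′ w ≤ pos L′ u) ws → All (λ w → pos L w ≤ pos L u) ws
    lower u≢e [] [] = []
    lower u≢e (w≢e ∷ avoids) (le ∷ les) = front-reflects L w≢e u≢e le ∷ lower u≢e avoids les

    reach-avoiding : ∀ {v u} → v ≢ e → WReach Adj c L′ v u → WReach Adj c L v u
    reach-avoiding {v} {u} v≢e (u≢v , ws , (W , uniq) , short , below) =
      let ws′ , W′ , sub , avoids = bypass _≟_ σ W uniq v≢e u≢e
      in u≢v , ws′ , (W′ , Unique-resp-⊆ sub uniq) , ≤-trans (length-mono-≤ sub) short ,
         lower u≢e avoids (All-resp-⊆ sub below)
      where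
        -- u = e would put u at position 0, before v
        u≢e : u ≢ e
        u≢e refl = <⇒≱ (front-first L v≢e) (walk-head W below)

    -- A walk a … u below u in L, with a a neighbour of e, gives u ∈ WReach_c[z]:
    -- prepend z, or cut the walk at z if it already passes through z.
    from-z : ∀ {a u tl} → u ≢ z → Adj e a → Walk Adj a u tl → Unique tl →
      suc (length tl) ≤ suc c → All (λ w → pos L w ≤ pos L u) tl → WReach Adj c L z u
    from-z {tl = tl} u≢z e~a rest uniq short below with z ∈? tl
    ... | yes z∈tl =
      let ws , W , sub = walk-suffix rest z∈tl
      in u≢z , ws , (W , Unique-resp-⊆ sub uniq) , ≤-trans (length-mono-≤ sub) (m≤n⇒m≤1+n (s≤s⁻¹ short)) ,
         All-resp-⊆ sub below
    ... | no z∉tl =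
      u≢z , z ∷ tl , (step z~a rest , ¬Any⇒All¬ tl z∉tl ∷ uniq) , short ,
      ≤-trans (z-least (closed e~a)) (walk-head rest below) ∷ below
      where
        z~a : Adj z _
        z~a = complete z∈clique (closed e~a) (λ { refl → z∉tl (walk-starts rest) })

    reach-rerouted : ∀ {u} → u ≢ z → WReach Adj c L′ e u → WReach Adj c L z u
    reach-rerouted u≢z (u≢e , _ , (here , _) , _) = ⊥-elim (u≢e refl)
    reach-rerouted u≢z (u≢e , _ , (step e~a rest , e∉tl ∷ uniq) , short , _ ∷ below) =
      from-z u≢z e~a rest uniq short (lower u≢e (All.map ≢-sym e∉tl) below)

    -- The image of z: e ∈ WReach_c[z] in L through the edge z e (needs c ≥ 1).
    reach-e : z ≢ e → WReach Adj c L z e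
    reach-e z≢e =
      ≢-sym z≢e , z ∷ e ∷ [] , (step (complete z∈clique self∈ z≢e) here , (z≢e ∷ []) ∷ [] ∷ []) ,
      s≤s 1≤c , z-least self∈ ∷ ≤-refl ∷ []

    retarget : V → V
    retarget u with u ≟ z
    ... | yes _ = e
    ... | no _ = u

    retarget-reach : ∀ {u} → WReach Adj c L′ e u → WReach Adj c L z (retarget u)
    retarget-reach {u} r with u ≟ z
    ... | yes refl = reach-e (proj₁ r)
    ... | no u≢z = reach-rerouted u≢z r

    retarget-injective : ∀ {u u′} → u ≢ e → u′ ≢ e → retarget u ≡ retarget u′ → u ≡ u′
    retarget-injective {u} {u′} u≢e u′≢e eq with u ≟ z | u′ ≟ z
    ... | yes u≡z | yes u′≡z = trans u≡z (sym u′≡z)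
    ... | yes _   | no _     = ⊥-elim (u′≢e (sym eq))
    ... | no _    | yes _    = ⊥-elim (u≢e eq)
    ... | no _    | no _     = eq

    front-wcol : ∀ {m} → WcolLe Adj c L m → WcolLe Adj c L′ m
    front-wcol H v with v ≟ e
    ... | no v≢e = AtMost-map (λ u → u) (reach-avoiding v≢e) (λ _ _ eq → eq) (H v)
    ... | yes refl =
      AtMost-map retarget retarget-reach (λ r r′ → retarget-injective (proj₁ r) (proj₁ r′)) (H z)

  moveAll-wcol : (c : ℕ) → 1 ≤ c → (L : Ordering V) (es : List V) → All Simplicial es →
    ∀ {m} → WcolLe Adj c L m → WcolLe Adj c (moveAllToFront L es) m
  moveAll-wcol c 1≤c L [] [] H = H
  moveAll-wcol c 1≤c L (e ∷ es) (σ ∷ σs) H =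
    moveAll-wcol c 1≤c (moveToFront L e) es σs (SimplicialFront.front-wcol c 1≤c L σ H)

  -- A star clique: a hub h adjacent to every member of a family g of
  -- pairwise adjacent vertices.
  star : ∀ {k} → V → (Fin k → V) → List V
  star h g = h ∷ map g (allFin _)

  module _ {k : ℕ} {h : V} {g : Fin k → V} where

    star-member : ∀ {a} → a ≡ h ⊎ (∃[ j ] a ≡ g j) → a ∈ star h g
    star-member (inj₁ refl) = Any.here refl
    star-member (inj₂ (j , refl)) = Any.there (∈-map⁺ g (∈-allFin j))

    star-view : ∀ {a} → a ∈ star h g → a ≡ h ⊎ (∃[ j ] a ≡ g j)
    star-view (Any.here a≡h) = inj₁ a≡h
    star-view (Any.there a∈) = let j , _ , a≡gj = ∈-map⁻ g a∈ in inj₂ (j , a≡gj)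

    star-simplicial : (i : Fin k) → (∀ j → Adj h (g j)) → (∀ {j j′} → j ≢ j′ → Adj (g j) (g j′)) →
      (∀ {a} → Adj (g i) a → a ≡ h ⊎ (∃[ j ] a ≡ g j)) → Simplicial (g i)
    star-simplicial i hub family neighbours = record
      { clique = star h g
      ; self∈ = star-member (inj₂ (i , refl))
      ; closed = star-member ∘ neighbours
      ; complete = λ a∈ b∈ → complete (star-view a∈) (star-view b∈)
      }
      where
        complete : ∀ {a b} → a ≡ h ⊎ (∃[ j ] a ≡ g j) → b ≡ h ⊎ (∃[ j ] b ≡ g j) → a ≢ b → Adj a b
        complete (inj₁ refl) (inj₁ refl) a≢b = ⊥-elim (a≢b refl)
        complete (inj₁ refl) (inj₂ (j , refl)) _ = hub j
        complete (inj₂ (j , refl)) (inj₁ refl) _ = Adj-sym (hub j)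
        complete (inj₂ (j , refl)) (inj₂ (j′ , refl)) a≢b = family (a≢b ∘ cong g)

module ElementGadget (I : SetCover) (c : ℕ) (x : Fin (n I)) where

  private
    V : Set
    V = VG I c x
    Adj : V → V → Set
    Adj = AdjG I c x

  Adj-sym : ∀ {a b} → Adj a b → Adj b a
  Adj-sym (inj₁ e) = inj₂ e
  Adj-sym (inj₂ e) = inj₁ e

  open Graph Adj Adj-sym

  data Pending : V → Set where
    inD1 : ∀ S i → Pending (d1 S i)
    inD2 : ∀ S i → Pending (d2 S i)
    inDS : ∀ S i → Pending (dS S i)

  pending? : Decidable Pending
  pending? (dX _) = no λ ()
  pending? (v1 _) = no λ ()
  pending? (d1 S i) = yes (inD1 S i)
  pending? (v2 _) = no λ ()
  pending? (d2 S i) = yes (inD2 S i)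
  pending? (dS S i) = yes (inDS S i)
  pending? (pth _ _) = no λ ()

  d1-neighbours : ∀ {S i a} → Adj (d1 S i) a → a ≡ v1 S ⊎ (∃[ j ] a ≡ d1 S j)
  d1-neighbours (inj₁ (eD1 _)) = inj₂ (_ , refl)
  d1-neighbours (inj₂ eD1v) = inj₁ refl
  d1-neighbours (inj₂ (eD1 _)) = inj₂ (_ , refl)

  d2-neighbours : ∀ {S i a} → Adj (d2 S i) a → a ≡ v2 S ⊎ (∃[ j ] a ≡ d2 S j)
  d2-neighbours (inj₁ (eD2 _)) = inj₂ (_ , refl)
  d2-neighbours (inj₂ eD2v) = inj₁ refl
  d2-neighbours (inj₂ (eD2 _)) = inj₂ (_ , refl)

  dS-neighbours : (p₁ : Fin (ell c)) → toℕ p₁ ≡ 0 →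
    ∀ {S i a} → Adj (dS S i) a → a ≡ pth S p₁ ⊎ (∃[ j ] a ≡ dS S j)
  dS-neighbours p₁ p₁≡0 (inj₁ (eDS _)) = inj₂ (_ , refl)
  dS-neighbours p₁ p₁≡0 (inj₂ (eDS _)) = inj₂ (_ , refl)
  dS-neighbours p₁ p₁≡0 (inj₂ (eP1DS j≡0)) = inj₁ (cong (pth _) (toℕ-injective (trans j≡0 (sym p₁≡0))))

  pending-simplicial : (p₁ : Fin (ell c)) → toℕ p₁ ≡ 0 → ∀ {e} → Pending e → Simplicial e
  pending-simplicial p₁ p₁≡0 (inD1 S i) =
    star-simplicial i (λ _ → inj₁ eD1v) (inj₁ ∘ eD1) d1-neighbours
  pending-simplicial p₁ p₁≡0 (inD2 S i) =
    star-simplicial i (λ _ → inj₁ eD2v) (inj₁ ∘ eD2) d2-neighbours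
  pending-simplicial p₁ p₁≡0 (inDS S i) =
    star-simplicial i (λ _ → inj₁ (eP1DS p₁≡0)) (inj₁ ∘ eDS) (dS-neighbours p₁ p₁≡0)

  normalise : Ordering V → Ordering V
  normalise L = moveAllToFront L (filter pending? (vertices L))

  normalise-wcol : (p₁ : Fin (ell c)) → toℕ p₁ ≡ 0 → 1 ≤ c → (L : Ordering V) →
    ∀ m → WcolLe Adj c L m → WcolLe Adj c (normalise L) m
  normalise-wcol p₁ p₁≡0 1≤c L m =
    moveAll-wcol c 1≤c L _ (All.map (pending-simplicial p₁ p₁≡0) (all-filter pending? (vertices L)))

  normalise-before : (L : Ordering V) {d r : V} → Pending d → ¬ Pending r →
    pos (normalise L) d < pos (normalise L) r
  normalise-before L pd ¬pr =
    moveAll-before L _ (∈-filter⁺ pending? (∈-vertices L _) pd)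
      (¬pr ∘ proj₂ ∘ ∈-filter⁻ pending? {xs = vertices L})

firstPathIndex : (c : ℕ) → 3 ≤ c → Σ (Fin (ell c)) λ j → toℕ j ≡ 0
firstPathIndex (suc (suc c)) _ = Fin.zero , refl
firstPathIndex (suc zero) (s≤s ())

mainTheorem5 : (I : SetCover) (c : ℕ) → 3 ≤ c → (x : Fin (n I)) →
    (L : Ordering (VG I c x)) → WcolLe (AdjG I c x) c L (tt I c) →
    Σ (Ordering (VG I c x)) λ L' →
      (∀ k → WcolLe (AdjG I c x) c L k → WcolLe (AdjG I c x) c L' k)
      × (∀ (S : SetsOf I x) →
           (∀ i → pos L' (d1 S i) < pos L' (v1 S))
         × (∀ i → pos L' (d2 S i) < pos L' (v2 S))
         × (∀ (j : Fin (ell c)) → toℕ j ≡ 0 →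
              ∀ i → pos L' (dS S i) < pos L' (pth S j)))
-- The normalised ordering works.
mainTheorem5 I c 3≤c x L _ =
  normalise L ,
  normalise-wcol p₁ p₁≡0 (≤-trans (s≤s z≤n) 3≤c) L ,
  λ S → (λ i → normalise-before L (inD1 S i) λ ()) ,
        (λ i → normalise-before L (inD2 S i) λ ()) ,
        (λ j _ i → normalise-before L (inDS S i) λ ())
  where
    open ElementGadget I c x
    p₁ : Fin (ell c)
    p₁ = proj₁ (firstPathIndex c 3≤c)
    p₁≡0 : toℕ p₁ ≡ 0
    p₁≡0 = proj₂ (firstPathIndex c 3≤c)
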